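{- Let $D$ be a finite list of distinct atoms and $r$ a PNL term. (1) If an atom $a$ is a free variable of the HOL term $[\![r]\!]_D$, then $a\in\mathrm{fa}(r)$. (2) For every permutation $\pi$, $[\![\pi\cdot r]\!]_D=\pi\cdot[\![r]\!]_D$, where on the right $\pi$ acts on HOL terms by renaming variables (atoms being HOL variables). Consequently the translation is well defined on $\alpha$-equivalence classes: if $r$ and $s$ are $\alpha$-equivalent then $[\![r]\!]_D=[\![s]\!]_D$.
   Context: PNL terms: atoms $a$, tuples, $\mathsf f(r)$, abstractions $[a]r$, moderated unknowns $\pi\cdot X$ ($\pi$ a finitely supported sort-preserving bijection of atoms; $X$ an unknown with permission set $\mathrm{pmss}(X)$). $\pi$ acts on PNL terms by $\pi\cdot a=\pi(a)$, $\pi\cdot[a]r=[\pi(a)](\pi\cdot r)$, $\pi\cdot(\pi'\cdot X)=(\pi\circ\pi')\cdot X$, homomorphically otherwise. Free atoms: $\mathrm{fa}(a)=\{a\}$, $\mathrm{fa}([a]r)=\mathrm{fa}(r)\setminus\{a\}$, $\mathrm{fa}(\pi\cdot X)=\{\pi(b)\mid b\in\mathrm{pmss}(X)\}$, unions otherwise. $\alpha$-equivalence on PNL terms: least congruent equivalence with $(b\ a)\cdot r\approx r$ when $a,b\notin\mathrm{fa}(r)$. Translation to HOL (simply-typed $\lambda$-terms with tuples; atoms are HOL variables; permutations act on HOL terms by renaming variables): constants $\mathsf g_{\mathsf f}$ for term-formers; for each unknown $X$ and finite list $D$ a non-atom HOL variable $X_D$. $[\![a]\!]_D=a$; tuples componentwise;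 $[\![\mathsf f(r)]\!]_D=\mathsf g_{\mathsf f}[\![r]\!]_D$; $[\![[a]r]\!]_D=\lambda a.[\![r]\!]_D$; $[\![\pi\cdot X]\!]_D=X_D$ applied in order to the atoms of $\pi\cdot(D\cap\mathrm{pmss}(X))$, where $D\cap\mathrm{pmss}(X)$ is the sublist of atoms of $D$ in $\mathrm{pmss}(X)$. -}

module Defs where

open import Data.Nat using (ℕ)
import Data.Nat as ℕ
open import Data.Bool using (Bool; true; false; if_then_else_)
open import Data.Product using (_×_; _,_; proj₁; proj₂; Σ-syntax; ∃-syntax)
open import Data.Product.Properties using (≡-dec)
open import Data.List using (List; []; _∷_; _++_; foldl; map; filterᵇ)
open import Data.List.Membership.Propositional using (_∈_; _∉_)
open import Data.List.Membership.Propositional.Properties using (∈-++⁺ˡ; ∈-++⁺ʳ)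
open import Data.List.Relation.Unary.Any using (Any; here; there)
open import Data.List.Relation.Binary.Pointwise using (Pointwise)
open import Relation.Nullary using (¬_; Dec; yes; no)
open import Relation.Binary.PropositionalEquality
  using (_≡_; _≢_; refl; sym; trans; cong)

Sort : Set
Sort = ℕ

Atom : Set
Atom = Sort × ℕ

sort : Atom → Sort
sort = proj₁

_≟ₐ_ : (a b : Atom) → Dec (a ≡ b)
_≟ₐ_ = ≡-dec ℕ._≟_ ℕ._≟_

record Perm : Set where
  field
    fun      : Atom → Atom
    inv      : Atom → Atom
    inv-l    : ∀ a → inv (fun a) ≡ a
    inv-r    : ∀ a → fun (inv a) ≡ a
    sort-pres : ∀ a → sort (fun a) ≡ sort a
    supp     : List Atom
    supp-ok  : ∀ a → a ∉ supp → fun a ≡ a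
open Perm public

_∘ₚ_ : Perm → Perm → Perm
π ∘ₚ π' = record
  { fun = λ a → fun π (fun π' a)
  ; inv = λ a → inv π' (inv π a)
  ; inv-l = λ a → trans (cong (inv π') (inv-l π (fun π' a))) (inv-l π' a)
  ; inv-r = λ a → trans (cong (fun π) (inv-r π' (inv π a))) (inv-r π a)
  ; sort-pres = λ a → trans (sort-pres π (fun π' a)) (sort-pres π' a)
  ; supp = supp π ++ supp π'
  ; supp-ok = λ a a∉ →
      trans (cong (fun π) (supp-ok π' a (λ m → a∉ (∈-++⁺ʳ (supp π) m))))
            (supp-ok π a (λ m → a∉ (∈-++⁺ˡ m)))
  }

swapFun : Atom → Atom → Atom → Atom
swapFun a b c with c ≟ₐ a
... | yes _ = b
... | no _ with c ≟ₐ b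
...   | yes _ = a
...   | no _  = c

private
  swap-invol : ∀ a b c → swapFun a b (swapFun a b c) ≡ c
  swap-invol a b c with c ≟ₐ a
  swap-invol a b c | yes refl with b ≟ₐ c
  ... | yes refl = refl
  ... | no b≢c with b ≟ₐ b
  ...   | yes _ = refl
  ...   | no b≢b = Data.Empty.⊥-elim (b≢b refl)
    where import Data.Empty
  swap-invol a b c | no c≢a with c ≟ₐ b
  swap-invol a b c | no c≢a | yes refl with a ≟ₐ a
  ... | yes _ = refl
  ... | no a≢a = Data.Empty.⊥-elim (a≢a refl)
    where import Data.Empty
  swap-invol a b c | no c≢a | no c≢b with c ≟ₐ a
  ... | yes c≡a = Data.Empty.⊥-elim (c≢a c≡a)
    where import Data.Empty
  ... | no _ with c ≟ₐ b
  ...   | yes c≡b = Data.Empty.⊥-elim (c≢b c≡b)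
    where import Data.Empty
  ...   | no _ = refl

  swap-sort : ∀ a b → sort a ≡ sort b → ∀ c → sort (swapFun a b c) ≡ sort c
  swap-sort a b e c with c ≟ₐ a
  ... | yes refl = sym e
  ... | no _ with c ≟ₐ b
  ...   | yes refl = e
  ...   | no _ = refl

  swap-supp : ∀ a b c → c ∉ (a ∷ b ∷ []) → swapFun a b c ≡ c
  swap-supp a b c c∉ with c ≟ₐ a
  ... | yes c≡a = Data.Empty.⊥-elim (c∉ (here c≡a))
    where import Data.Empty
  ... | no _ with c ≟ₐ b
  ...   | yes c≡b = Data.Empty.⊥-elim (c∉ (there (here c≡b)))
    where import Data.Empty
  ...   | no _ = refl

swap : (a b : Atom) → sort a ≡ sort b → Perm
swap a b e = record
  { fun = swapFun a b
  ; inv = swapFun a b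
  ; inv-l = swap-invol a b
  ; inv-r = swap-invol a b
  ; sort-pres = swap-sort a b e
  ; supp = a ∷ b ∷ []
  ; supp-ok = swap-supp a b
  }

-- PNL terms over term-formers F and unknowns U.
-- Permission sets are given by   pmss : U → Atom → Bool   (decidable sets).

data Term (F U : Set) : Set where
  atom  : Atom → Term F U
  tuple : List (Term F U) → Term F U
  app   : F → Term F U → Term F U
  abs   : Atom → Term F U → Term F U
  unk   : Perm → U → Term F U

module _ {F U : Set} where
  mutual
    act : Perm → Term F U → Term F U
    act π (atom a)   = atom (fun π a)
    act π (tuple rs) = tuple (actL π rs)
    act π (app f r)  = app f (act π r)
    act π (abs a r)  = abs (fun π a) (act π r)
    act π (unk π' X) = unk (π ∘ₚ π') X

    actL : Perm → List (Term F U) → List (Term F U)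
    actL π []       = []
    actL π (r ∷ rs) = act π r ∷ actL π rs

  data FA (pmss : U → Atom → Bool) (a : Atom) : Term F U → Set where
    fa-atom  : FA pmss a (atom a)
    fa-tuple : ∀ {rs} → Any (FA pmss a) rs → FA pmss a (tuple rs)
    fa-app   : ∀ {f r} → FA pmss a r → FA pmss a (app f r)
    fa-abs   : ∀ {b r} → a ≢ b → FA pmss a r → FA pmss a (abs b r)
    fa-unk   : ∀ {π X} b → pmss X b ≡ true → a ≡ fun π b → FA pmss a (unk π X)

  -- Permutations are functions, so
  -- π·X and π'·X are the same term when π and π' agree pointwise (≈-unk).
  data AlphaEq (pmss : U → Atom → Bool) : Term F U → Term F U → Set where
    ≈-refl  : ∀ {r} → AlphaEq pmss r r
    ≈-unk   : ∀ {π π' X} → (∀ c → fun π c ≡ fun π' c) →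
              AlphaEq pmss (unk π X) (unk π' X)
    ≈-sym   : ∀ {r s} → AlphaEq pmss r s → AlphaEq pmss s r
    ≈-trans : ∀ {r s t} → AlphaEq pmss r s → AlphaEq pmss s t → AlphaEq pmss r t
    ≈-tuple : ∀ {rs ss} → Pointwise (AlphaEq pmss) rs ss →
              AlphaEq pmss (tuple rs) (tuple ss)
    ≈-app   : ∀ {f r s} → AlphaEq pmss r s → AlphaEq pmss (app f r) (app f s)
    ≈-abs   : ∀ {a r s} → AlphaEq pmss r s → AlphaEq pmss (abs a r) (abs a s)
    ≈-swap  : ∀ {a b r} (e : sort b ≡ sort a) →
              ¬ FA pmss a r → ¬ FA pmss b r →
              AlphaEq pmss (act (swap b a e) r) r

-- HOL terms (untyped raw syntax of simply-typed λ-terms with tuples).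
-- Variables: atoms (var a) and the non-atom variables X_D (xvar X D).

data HTerm (F U : Set) : Set where
  var   : Atom → HTerm F U
  xvar  : U → List Atom → HTerm F U
  const : F → HTerm F U
  happ  : HTerm F U → HTerm F U → HTerm F U
  lam   : Atom → HTerm F U → HTerm F U
  htuple : List (HTerm F U) → HTerm F U

module _ {F U : Set} where
  mutual
    hact : Perm → HTerm F U → HTerm F U
    hact π (var a)     = var (fun π a)
    hact π (xvar X D)  = xvar X D
    hact π (const f)   = const f
    hact π (happ t u)  = happ (hact π t) (hact π u)
    hact π (lam a t)   = lam (fun π a) (hact π t)
    hact π (htuple ts) = htuple (hactL π ts)

    hactL : Perm → List (HTerm F U) → List (HTerm F U)
    hactL π []       = []
    hactL π (t ∷ ts) = hact π t ∷ hactL π ts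

  data FV (a : Atom) : HTerm F U → Set where
    fv-var   : FV a (var a)
    fv-appˡ  : ∀ {t u} → FV a t → FV a (happ t u)
    fv-appʳ  : ∀ {t u} → FV a u → FV a (happ t u)
    fv-lam   : ∀ {b t} → a ≢ b → FV a t → FV a (lam b t)
    fv-tuple : ∀ {ts} → Any (FV a) ts → FV a (htuple ts)

  -- α-equivalence of HOL terms (HOL terms are taken up to α-conversion):
  -- least congruent equivalence with (b a)·t ≈ t whenever a, b ∉ fv(t).
  data HAlphaEq : HTerm F U → HTerm F U → Set where
    ≈h-refl  : ∀ {t} → HAlphaEq t t
    ≈h-sym   : ∀ {t u} → HAlphaEq t u → HAlphaEq u t
    ≈h-trans : ∀ {t u v} → HAlphaEq t u → HAlphaEq u v → HAlphaEq t v
    ≈h-app   : ∀ {t t' u u'} → HAlphaEq t t' → HAlphaEq u u' →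
               HAlphaEq (happ t u) (happ t' u')
    ≈h-lam   : ∀ {a t u} → HAlphaEq t u → HAlphaEq (lam a t) (lam a u)
    ≈h-tuple : ∀ {ts us} → Pointwise HAlphaEq ts us →
               HAlphaEq (htuple ts) (htuple us)
    ≈h-swap  : ∀ {a b t} (e : sort b ≡ sort a) →
               ¬ FV a t → ¬ FV b t → HAlphaEq (hact (swap b a e) t) t

applyAtoms : ∀ {F U} → HTerm F U → List Atom → HTerm F U
applyAtoms h as = foldl (λ t a → happ t (var a)) h as

module _ {F U : Set} (pmss : U → Atom → Bool) (D : List Atom) where
  mutual
    tr : Term F U → HTerm F U
    tr (atom a)   = var a
    tr (tuple rs) = htuple (trL rs)
    tr (app f r)  = happ (const f) (tr r)
    tr (abs a r)  = lam a (tr r)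
    tr (unk π X)  = applyAtoms (xvar X D) (map (fun π) (filterᵇ (pmss X) D))

    trL : List (Term F U) → List (HTerm F U)
    trL []       = []
    trL (r ∷ rs) = tr r ∷ trL rs

{-# OPTIONS --safe #-}
module Submission where

-- The translation is structural, so free variables and renamings pass through
-- it clause by clause.  At an unknown, the only variables of X_D π(b₁) … π(bₖ)
-- are the atoms π(bᵢ) with bᵢ ∈ D ∩ pmss(X), which are free in π·X, and renaming
-- them by π' gives X_D (π'∘π)(b₁) … (π'∘π)(bₖ).  Hence a swapping of atoms not
-- free in r becomes a swapping of variables not free in ⟦r⟧_D, which is an
-- α-conversion of HOL terms.

open import Defs
open import Data.Bool using (Bool)
open import Data.Bool.Properties using (T-≡)
open import Data.Product using (_×_; _,_)
open import Data.Sum using (_⊎_; inj₁; inj₂)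
open import Data.List using (List; []; _∷_; map; filterᵇ)
open import Data.List.Properties using (map-∘; map-cong)
open import Data.List.Membership.Propositional using (_∈_)
open import Data.List.Membership.Propositional.Properties using (∈-map⁻; ∈-filter⁻)
open import Data.List.Relation.Unary.Any using (Any; here; there)
open import Data.List.Relation.Binary.Pointwise using (Pointwise; []; _∷_)
open import Data.List.Relation.Unary.Unique.Propositional using (Unique)
open import Function using (_∘_)
open import Function.Bundles using (Equivalence)
open import Relation.Nullary using (¬_)
open import Relation.Nullary.Decidable using (T?)
open import Relation.Binary.PropositionalEquality
  using (_≡_; refl; sym; cong; cong₂; subst; module ≡-Reasoning)

module _ {F U : Set} where

  FV-applyAtoms⁻ : ∀ {a} (h : HTerm F U) as →
                   FV a (applyAtoms h as) → FV a h ⊎ a ∈ as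
  FV-applyAtoms⁻ h []       fv = inj₁ fv
  FV-applyAtoms⁻ h (b ∷ bs) fv with FV-applyAtoms⁻ (happ h (var b)) bs fv
  ... | inj₁ (fv-appˡ fv′)     = inj₁ fv′
  ... | inj₁ (fv-appʳ fv-var) = inj₂ (here refl)
  ... | inj₂ a∈bs             = inj₂ (there a∈bs)

  hact-applyAtoms : ∀ π (h : HTerm F U) as →
                    hact π (applyAtoms h as) ≡ applyAtoms (hact π h) (map (fun π) as)
  hact-applyAtoms π h []       = refl
  hact-applyAtoms π h (b ∷ bs) = hact-applyAtoms π (happ h (var b)) bs

  ≡⇒HAlphaEq : {t u : HTerm F U} → t ≡ u → HAlphaEq t u
  ≡⇒HAlphaEq refl = ≈h-refl

module _ {F U : Set} (pmss : U → Atom → Bool) (D : List Atom) where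

  FV-tr-unk⇒FA : ∀ {a} π X → FV a (tr pmss D (unk {F = F} π X)) → FA pmss a (unk {F = F} π X)
  FV-tr-unk⇒FA π X fv with FV-applyAtoms⁻ (xvar {F = F} X D) (map (fun π) (filterᵇ (pmss X) D)) fv
  ... | inj₁ ()
  ... | inj₂ a∈πD with ∈-map⁻ (fun π) a∈πD
  ...   | b , b∈D∩X , a≡πb with ∈-filter⁻ (T? ∘ pmss X) {xs = D} b∈D∩X
  ...     | _ , b∈X = fa-unk b (Equivalence.to T-≡ b∈X) a≡πb

  mutual
    FV-tr⇒FA : (r : Term F U) (a : Atom) → FV a (tr pmss D r) → FA pmss a r
    FV-tr⇒FA (atom b)   a fv-var          = fa-atom
    FV-tr⇒FA (tuple rs) a (fv-tuple fv)   = fa-tuple (FV-trL⇒FA rs a fv)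
    FV-tr⇒FA (app f r)  a (fv-appʳ fv)    = fa-app (FV-tr⇒FA r a fv)
    FV-tr⇒FA (abs b r)  a (fv-lam a≢b fv) = fa-abs a≢b (FV-tr⇒FA r a fv)
    FV-tr⇒FA (unk π X)  a fv              = FV-tr-unk⇒FA π X fv

    FV-trL⇒FA : (rs : List (Term F U)) (a : Atom) →
                Any (FV a) (trL pmss D rs) → Any (FA pmss a) rs
    FV-trL⇒FA (r ∷ rs) a (here fv)  = here (FV-tr⇒FA r a fv)
    FV-trL⇒FA (r ∷ rs) a (there fv) = there (FV-trL⇒FA rs a fv)

  tr-act-unk : ∀ π π′ X → tr {F = F} pmss D (act π (unk π′ X)) ≡ hact π (tr pmss D (unk π′ X))
  tr-act-unk π π′ X = begin
    applyAtoms (xvar X D) (map (fun π ∘ fun π′) D∩X)       ≡⟨ cong (applyAtoms (xvar X D)) (map-∘ D∩X) ⟩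
    applyAtoms (xvar X D) (map (fun π) (map (fun π′) D∩X)) ≡⟨ hact-applyAtoms π (xvar X D) (map (fun π′) D∩X) ⟨
    hact π (applyAtoms (xvar X D) (map (fun π′) D∩X))      ∎
    where
      open ≡-Reasoning
      D∩X = filterᵇ (pmss X) D

  mutual
    tr-act : (π : Perm) (r : Term F U) → tr pmss D (act π r) ≡ hact π (tr pmss D r)
    tr-act π (atom a)   = refl
    tr-act π (tuple rs) = cong htuple (trL-actL π rs)
    tr-act π (app f r)  = cong (happ (const f)) (tr-act π r)
    tr-act π (abs a r)  = cong (lam (fun π a)) (tr-act π r)
    tr-act π (unk π′ X) = tr-act-unk π π′ X

    trL-actL : (π : Perm) (rs : List (Term F U)) →
               trL pmss D (actL π rs) ≡ hactL π (trL pmss D rs)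
    trL-actL π []       = refl
    trL-actL π (r ∷ rs) = cong₂ _∷_ (tr-act π r) (trL-actL π rs)

  tr-swap-fresh : ∀ {a b} (e : sort b ≡ sort a) (r : Term F U) →
                  ¬ FA pmss a r → ¬ FA pmss b r →
                  HAlphaEq (tr pmss D (act (swap b a e) r)) (tr pmss D r)
  tr-swap-fresh {a} {b} e r a∉r b∉r =
    subst (λ t → HAlphaEq t (tr pmss D r)) (sym (tr-act (swap b a e) r))
      (≈h-swap e (a∉r ∘ FV-tr⇒FA r a) (b∉r ∘ FV-tr⇒FA r b))

  mutual
    tr-resp-≈ : (r s : Term F U) → AlphaEq pmss r s → HAlphaEq (tr pmss D r) (tr pmss D s)
    tr-resp-≈ r .r ≈-refl = ≈h-refl
    tr-resp-≈ (unk π X) (unk π′ .X) (≈-unk π≗π′) =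
      ≡⇒HAlphaEq (cong (applyAtoms (xvar X D)) (map-cong π≗π′ (filterᵇ (pmss X) D)))
    tr-resp-≈ r s (≈-sym s≈r)               = ≈h-sym (tr-resp-≈ s r s≈r)
    tr-resp-≈ r s (≈-trans {s = m} r≈m m≈s) = ≈h-trans (tr-resp-≈ r m r≈m) (tr-resp-≈ m s m≈s)
    tr-resp-≈ (tuple rs) (tuple ss) (≈-tuple rs≈ss) = ≈h-tuple (trL-resp-≈ rs ss rs≈ss)
    tr-resp-≈ (app f r) (app .f s) (≈-app r≈s)     = ≈h-app ≈h-refl (tr-resp-≈ r s r≈s)
    tr-resp-≈ (abs a r) (abs .a s) (≈-abs r≈s)     = ≈h-lam (tr-resp-≈ r s r≈s)
    tr-resp-≈ ._ s (≈-swap e a∉s b∉s)              = tr-swap-fresh e s a∉s b∉s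

    trL-resp-≈ : (rs ss : List (Term F U)) → Pointwise (AlphaEq pmss) rs ss →
                 Pointwise HAlphaEq (trL pmss D rs) (trL pmss D ss)
    trL-resp-≈ []       []       []            = []
    trL-resp-≈ (r ∷ rs) (s ∷ ss) (r≈s ∷ rs≈ss) = tr-resp-≈ r s r≈s ∷ trL-resp-≈ rs ss rs≈ss

lemma4p6 : {F U : Set} (pmss : U → Atom → Bool) (D : List Atom) → Unique D →
    ((r : Term F U) (a : Atom) → FV a (tr pmss D r) → FA pmss a r)
    × ((π : Perm) (r : Term F U) → tr pmss D (act π r) ≡ hact π (tr pmss D r))
    × ((r s : Term F U) → AlphaEq pmss r s → HAlphaEq (tr pmss D r) (tr pmss D s))
lemma4p6 pmss D _ = FV-tr⇒FA pmss D , tr-act pmss D , tr-resp-≈ pmss D
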